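{- Let $R$ be a commutative ring with $1$. For sequences of polynomials $\{u_m(q)\}_{m=1}^\infty$ and $\{v_m(q)\}_{m=1}^\infty$ in $R[q]$, we have $[m+n]_q = u_m(q)[m]_q + v_m(q)[n]_q$ for all positive integers $m,n$ if and only if $u_m(q)=1$ and $v_m(q)=q^m$ for all $m$. Furthermore, there do not exist sequences of polynomials $\{u_m(q)\}_{m=1}^\infty$ and $\{v_n(q)\}_{n=1}^\infty$ in $R[q]$ such that $[m+n]_q = u_m(q)[m]_q + v_n(q)[n]_q$ for all positive integers $m,n$.
   Context: For a positive integer $n$, the quantum integer $[n]_q$ is the polynomial $1+q+q^2+\cdots+q^{n-1}$. -}

module Defs where

open import Level using (Level)
open import Algebra.Bundles using (CommutativeRing)
open import Data.Nat using (ℕ; zero; suc)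
open import Data.List using (List; []; _∷_; map)

-- Univariate polynomials R[q] over a commutative ring R, represented by
-- coefficient lists (lowest degree first).  Two polynomials are equal
-- iff all their coefficients agree (trailing zeros are irrelevant).
module Poly {c ℓ : Level} (R : CommutativeRing c ℓ) where
  open CommutativeRing R

  Pol : Set c
  Pol = List Carrier

  coeff : Pol → ℕ → Carrier
  coeff []      _       = 0#
  coeff (a ∷ p) zero    = a
  coeff (a ∷ p) (suc i) = coeff p i

  infix 4 _≋_
  _≋_ : Pol → Pol → Set ℓ
  p ≋ r = ∀ i → coeff p i ≈ coeff r i

  infixl 6 _⊕_
  _⊕_ : Pol → Pol → Pol
  []      ⊕ r       = r
  (a ∷ p) ⊕ []      = a ∷ p
  (a ∷ p) ⊕ (b ∷ r) = (a + b) ∷ (p ⊕ r)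

  infixl 7 _⊗_
  _⊗_ : Pol → Pol → Pol
  []      ⊗ r = []
  (a ∷ p) ⊗ r = map (a *_) r ⊕ (0# ∷ (p ⊗ r))

  one : Pol
  one = 1# ∷ []

  X : Pol
  X = 0# ∷ 1# ∷ []

  infixr 8 _^^_
  _^^_ : Pol → ℕ → Pol
  p ^^ zero  = one
  p ^^ suc n = p ⊗ (p ^^ n)

  [_]q : ℕ → Pol
  [ zero ]q  = []
  [ suc n ]q = [ n ]q ⊕ (X ^^ n)

module Submission where

open import Defs
open import Algebra.Bundles using (CommutativeRing)
open import Data.Nat using (ℕ; _+_; _≤_)
open import Data.Product using (_×_; ∃₂)
open import Function.Bundles using (_⇔_)
open import Relation.Nullary using (¬_)

open import Level using (Level)
open import Data.Nat using (zero; suc; s≤s; z≤n)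
import Data.Nat.Properties as ℕ
open import Data.List using ([]; _∷_; map; drop)
open import Data.Product using (_,_; proj₁; proj₂)
open import Function.Bundles using (mk⇔)
open import Relation.Binary.Bundles using (Setoid)
import Relation.Binary.PropositionalEquality as ≡
import Relation.Binary.Reasoning.Setoid as SetoidReasoning
import Algebra.Properties.CommutativeSemigroup as CommutativeSemigroupProperties
import Algebra.Properties.Group as GroupProperties

-- Write [n] for [n]_q.  Comparing the cases n = 1 and n = 2 of
-- [m+n] = u_m [m] + v_m [n] gives q^(m+1) = v_m q, so v_m = q^m; then
-- u_m [m] = [m], and [m] has constant term 1, so u_m = 1.  Conversely
-- [m+n] = [m] + q^m [n].  If instead v depended on n, the right-hand side
-- would be a sum f(m) + g(n), hence [2] + [4] = [3] + [3]; but only [4] has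
-- a q^3 term.

module QuantumIntegers {c ℓ : Level} (R : CommutativeRing c ℓ) where

  open CommutativeRing R hiding (_+_; zero)
  open CommutativeRing R using () renaming (_+_ to _+ᵣ_)
  open CommutativeSemigroupProperties +-commutativeSemigroup using (interchange)
  open GroupProperties +-group using ()
    renaming (∙-cancelˡ to +ᵣ-cancelˡ; ∙-cancelʳ to +ᵣ-cancelʳ)
  open Poly R

  infix 4 _≃_
  -- _≋_ unfolds to a Π-type over coefficients, from which Agda cannot recover
  -- the polynomials; this record restores inference.
  record _≃_ (p r : Pol) : Set ℓ where
    constructor coeffwise
    field coeff-≈ : p ≋ r
  open _≃_

  variable
    p p′ r r′ s : Pol

  ≃-setoid : Setoid c ℓ
  ≃-setoid = record
    { Carrier       = Pol
    ; _≈_           = _≃_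
    ; isEquivalence = record
      { refl  = coeffwise λ _ → refl
      ; sym   = λ eq → coeffwise λ i → sym (eq .coeff-≈ i)
      ; trans = λ eq eq′ → coeffwise λ i → trans (eq .coeff-≈ i) (eq′ .coeff-≈ i)
      }
    }

  open Setoid ≃-setoid public using ()
    renaming (refl to ≃-refl; sym to ≃-sym; trans to ≃-trans; reflexive to ≃-reflexive)

  ∷-cong : ∀ {a b} → a ≈ b → p ≃ r → a ∷ p ≃ b ∷ r
  ∷-cong a≈b p≃r .coeff-≈ zero    = a≈b
  ∷-cong a≈b p≃r .coeff-≈ (suc i) = p≃r .coeff-≈ i

  coeff-drop : ∀ p i → coeff (drop 1 p) i ≡.≡ coeff p (suc i)
  coeff-drop []      i = ≡.refl
  coeff-drop (a ∷ p) i = ≡.refl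

  drop-cong : p ≃ p′ → drop 1 p ≃ drop 1 p′
  drop-cong {p} {p′} p≃p′ .coeff-≈ i =
    trans (reflexive (coeff-drop p i)) (trans (p≃p′ .coeff-≈ (suc i)) (reflexive (≡.sym (coeff-drop p′ i))))

  coeff-⊕ : ∀ p r i → coeff (p ⊕ r) i ≈ coeff p i +ᵣ coeff r i
  coeff-⊕ []      r       i       = sym (+-identityˡ _)
  coeff-⊕ (a ∷ p) []      zero    = sym (+-identityʳ _)
  coeff-⊕ (a ∷ p) []      (suc i) = sym (+-identityʳ _)
  coeff-⊕ (a ∷ p) (b ∷ r) zero    = refl
  coeff-⊕ (a ∷ p) (b ∷ r) (suc i) = coeff-⊕ p r i

  ⊕-cong : p ≃ p′ → r ≃ r′ → p ⊕ r ≃ p′ ⊕ r′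
  ⊕-cong {p} {p′} {r} {r′} p≃p′ r≃r′ .coeff-≈ i =
    trans (coeff-⊕ p r i) (trans (+-cong (p≃p′ .coeff-≈ i) (r≃r′ .coeff-≈ i)) (sym (coeff-⊕ p′ r′ i)))

  ⊕-congˡ : r ≃ r′ → p ⊕ r ≃ p ⊕ r′
  ⊕-congˡ = ⊕-cong ≃-refl

  ⊕-congʳ : p ≃ p′ → p ⊕ r ≃ p′ ⊕ r
  ⊕-congʳ p≃p′ = ⊕-cong p≃p′ ≃-refl

  ⊕-identityʳ : ∀ p → p ⊕ [] ≃ p
  ⊕-identityʳ p .coeff-≈ i = trans (coeff-⊕ p [] i) (+-identityʳ _)

  ⊕-assoc : ∀ p r s → (p ⊕ r) ⊕ s ≃ p ⊕ (r ⊕ s)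
  ⊕-assoc p r s .coeff-≈ i = begin
    coeff ((p ⊕ r) ⊕ s) i                  ≈⟨ trans (coeff-⊕ (p ⊕ r) s i) (+-congʳ (coeff-⊕ p r i)) ⟩
    (coeff p i +ᵣ coeff r i) +ᵣ coeff s i  ≈⟨ +-assoc _ _ _ ⟩
    coeff p i +ᵣ (coeff r i +ᵣ coeff s i)  ≈⟨ trans (coeff-⊕ p (r ⊕ s) i) (+-congˡ (coeff-⊕ r s i)) ⟨
    coeff (p ⊕ (r ⊕ s)) i                  ∎
    where open SetoidReasoning setoid

  ⊕-cancelˡ : ∀ p → p ⊕ r ≃ p ⊕ s → r ≃ s
  ⊕-cancelˡ {r} {s} p eq .coeff-≈ i =
    +ᵣ-cancelˡ (coeff p i) _ _ (trans (sym (coeff-⊕ p r i)) (trans (eq .coeff-≈ i) (coeff-⊕ p s i)))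

  ⊕-cancelʳ : ∀ p → r ⊕ p ≃ s ⊕ p → r ≃ s
  ⊕-cancelʳ {r} {s} p eq .coeff-≈ i =
    +ᵣ-cancelʳ (coeff p i) _ _ (trans (sym (coeff-⊕ r p i)) (trans (eq .coeff-≈ i) (coeff-⊕ s p i)))

  coeff-map-* : ∀ a p i → coeff (map (a *_) p) i ≈ a * coeff p i
  coeff-map-* a []      i       = sym (zeroʳ a)
  coeff-map-* a (b ∷ p) zero    = refl
  coeff-map-* a (b ∷ p) (suc i) = coeff-map-* a p i

  -- These two equations determine ⊗ up to ≃; the laws of ⊗ below follow from
  -- them by induction on the coefficient index.
  coeff-⊗-zero : ∀ p r → coeff (p ⊗ r) 0 ≈ coeff p 0 * coeff r 0
  coeff-⊗-zero []      r = sym (zeroˡ _)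
  coeff-⊗-zero (a ∷ p) r =
    trans (coeff-⊕ (map (a *_) r) _ 0) (trans (+-identityʳ _) (coeff-map-* a r 0))

  coeff-⊗-suc : ∀ p r i →
    coeff (p ⊗ r) (suc i) ≈ coeff p 0 * coeff r (suc i) +ᵣ coeff (drop 1 p ⊗ r) i
  coeff-⊗-suc []      r i = sym (trans (+-congʳ (zeroˡ _)) (+-identityˡ _))
  coeff-⊗-suc (a ∷ p) r i = trans (coeff-⊕ (map (a *_) r) _ (suc i)) (+-congʳ (coeff-map-* a r (suc i)))

  ⊗-congʳ : ∀ r → p ≃ p′ → p ⊗ r ≃ p′ ⊗ r
  ⊗-congʳ {p} {p′} r p≃p′ .coeff-≈ zero =
    trans (coeff-⊗-zero p r) (trans (*-congʳ (p≃p′ .coeff-≈ 0)) (sym (coeff-⊗-zero p′ r)))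
  ⊗-congʳ {p} {p′} r p≃p′ .coeff-≈ (suc i) =
    trans (coeff-⊗-suc p r i)
      (trans (+-cong (*-congʳ (p≃p′ .coeff-≈ 0)) (⊗-congʳ r (drop-cong p≃p′) .coeff-≈ i))
        (sym (coeff-⊗-suc p′ r i)))

  ⊗-congˡ : ∀ p → r ≃ r′ → p ⊗ r ≃ p ⊗ r′
  ⊗-congˡ {r} {r′} p r≃r′ .coeff-≈ zero =
    trans (coeff-⊗-zero p r) (trans (*-congˡ (r≃r′ .coeff-≈ 0)) (sym (coeff-⊗-zero p r′)))
  ⊗-congˡ {r} {r′} p r≃r′ .coeff-≈ (suc i) =
    trans (coeff-⊗-suc p r i)
      (trans (+-cong (*-congˡ (r≃r′ .coeff-≈ (suc i))) (⊗-congˡ (drop 1 p) r≃r′ .coeff-≈ i))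
        (sym (coeff-⊗-suc p r′ i)))

  ⊗-distribˡ : ∀ p r s → p ⊗ (r ⊕ s) ≃ p ⊗ r ⊕ p ⊗ s
  ⊗-distribˡ p r s .coeff-≈ zero = begin
    coeff (p ⊗ (r ⊕ s)) 0                           ≈⟨ trans (coeff-⊗-zero p _) (*-congˡ (coeff-⊕ r s 0)) ⟩
    coeff p 0 * (coeff r 0 +ᵣ coeff s 0)            ≈⟨ distribˡ _ _ _ ⟩
    coeff p 0 * coeff r 0 +ᵣ coeff p 0 * coeff s 0
      ≈⟨ trans (coeff-⊕ (p ⊗ r) _ 0) (+-cong (coeff-⊗-zero p r) (coeff-⊗-zero p s)) ⟨
    coeff (p ⊗ r ⊕ p ⊗ s) 0                         ∎
    where open SetoidReasoning setoid
  ⊗-distribˡ p r s .coeff-≈ (suc i) = begin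
    coeff (p ⊗ (r ⊕ s)) (suc i)
      ≈⟨ coeff-⊗-suc p _ i ⟩
    p₀ * coeff (r ⊕ s) (suc i) +ᵣ coeff (drop 1 p ⊗ (r ⊕ s)) i
      ≈⟨ +-cong (trans (*-congˡ (coeff-⊕ r s (suc i))) (distribˡ _ _ _))
                (trans (⊗-distribˡ (drop 1 p) r s .coeff-≈ i) (coeff-⊕ (drop 1 p ⊗ r) _ i)) ⟩
    (p₀ * coeff r (suc i) +ᵣ p₀ * coeff s (suc i)) +ᵣ (coeff (drop 1 p ⊗ r) i +ᵣ coeff (drop 1 p ⊗ s) i)
      ≈⟨ interchange _ _ _ _ ⟩
    (p₀ * coeff r (suc i) +ᵣ coeff (drop 1 p ⊗ r) i) +ᵣ (p₀ * coeff s (suc i) +ᵣ coeff (drop 1 p ⊗ s) i)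
      ≈⟨ trans (coeff-⊕ (p ⊗ r) _ (suc i)) (+-cong (coeff-⊗-suc p r i) (coeff-⊗-suc p s i)) ⟨
    coeff (p ⊗ r ⊕ p ⊗ s) (suc i)
      ∎
    where
    open SetoidReasoning setoid
    p₀ = coeff p 0

  ⊗-identityˡ : ∀ p → one ⊗ p ≃ p
  ⊗-identityˡ p .coeff-≈ zero    = trans (coeff-⊗-zero one p) (*-identityˡ _)
  ⊗-identityˡ p .coeff-≈ (suc i) = trans (coeff-⊗-suc one p i) (trans (+-identityʳ _) (*-identityˡ _))

  ⊗-identityʳ : ∀ p → p ⊗ one ≃ p
  ⊗-identityʳ p .coeff-≈ zero    = trans (coeff-⊗-zero p one) (*-identityʳ _)
  ⊗-identityʳ p .coeff-≈ (suc i) =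
    trans (coeff-⊗-suc p one i)
      (trans (+-congʳ (zeroʳ _))
        (trans (+-identityˡ _) (trans (⊗-identityʳ (drop 1 p) .coeff-≈ i) (reflexive (coeff-drop p i)))))

  ⊗-zeroʳ : ∀ p → p ⊗ [] ≃ []
  ⊗-zeroʳ p .coeff-≈ zero    = trans (coeff-⊗-zero p []) (zeroʳ _)
  ⊗-zeroʳ p .coeff-≈ (suc i) =
    trans (coeff-⊗-suc p [] i) (trans (+-cong (zeroʳ _) (⊗-zeroʳ (drop 1 p) .coeff-≈ i)) (+-identityˡ _))

  0∷-⊗ : ∀ p r → (0# ∷ p) ⊗ r ≃ 0# ∷ p ⊗ r
  0∷-⊗ p r .coeff-≈ zero    = trans (coeff-⊗-zero (0# ∷ p) r) (zeroˡ _)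
  0∷-⊗ p r .coeff-≈ (suc i) = trans (coeff-⊗-suc (0# ∷ p) r i) (trans (+-congʳ (zeroˡ _)) (+-identityˡ _))

  ⊗-0∷ : ∀ p r → p ⊗ (0# ∷ r) ≃ 0# ∷ p ⊗ r
  ⊗-0∷ p r .coeff-≈ zero          = trans (coeff-⊗-zero p (0# ∷ r)) (zeroʳ _)
  ⊗-0∷ p r .coeff-≈ (suc zero)    =
    trans (coeff-⊗-suc p (0# ∷ r) 0)
      (trans (+-congˡ (⊗-0∷ (drop 1 p) r .coeff-≈ 0)) (trans (+-identityʳ _) (sym (coeff-⊗-zero p r))))
  ⊗-0∷ p r .coeff-≈ (suc (suc i)) =
    trans (coeff-⊗-suc p (0# ∷ r) (suc i))
      (trans (+-congˡ (⊗-0∷ (drop 1 p) r .coeff-≈ (suc i))) (sym (coeff-⊗-suc p r i)))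

  ⊗-cancelʳ : ∀ r → coeff r 0 ≈ 1# → p ⊗ r ≃ s ⊗ r → p ≃ s
  ⊗-cancelʳ {p} {s} r r₀≈1 eq .coeff-≈ zero = begin
    coeff p 0              ≈⟨ trans (*-congˡ r₀≈1) (*-identityʳ _) ⟨
    coeff p 0 * coeff r 0  ≈⟨ trans (sym (coeff-⊗-zero p r)) (trans (eq .coeff-≈ 0) (coeff-⊗-zero s r)) ⟩
    coeff s 0 * coeff r 0  ≈⟨ trans (*-congˡ r₀≈1) (*-identityʳ _) ⟩
    coeff s 0              ∎
    where open SetoidReasoning setoid
  ⊗-cancelʳ {p} {s} r r₀≈1 eq .coeff-≈ (suc i) =
    trans (sym (reflexive (coeff-drop p i)))
      (trans (⊗-cancelʳ {drop 1 p} {drop 1 s} r r₀≈1 drop-eq .coeff-≈ i) (reflexive (coeff-drop s i)))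
    where
    -- The constant terms of p and s agree, so by coeff-⊗-suc their tails agree after multiplying by r.
    drop-eq : drop 1 p ⊗ r ≃ drop 1 s ⊗ r
    drop-eq .coeff-≈ j = +ᵣ-cancelˡ (coeff s 0 * coeff r (suc j)) _ _
      (trans (+-congʳ (*-congʳ (sym (⊗-cancelʳ {p} {s} r r₀≈1 eq .coeff-≈ 0))))
        (trans (sym (coeff-⊗-suc p r j)) (trans (eq .coeff-≈ (suc j)) (coeff-⊗-suc s r j))))

  X^^-suc : ∀ n → X ^^ suc n ≃ 0# ∷ X ^^ n
  X^^-suc n = ≃-trans (0∷-⊗ one (X ^^ n)) (∷-cong refl (⊗-identityˡ (X ^^ n)))

  X^^-+ : ∀ m n → X ^^ (m + n) ≃ X ^^ m ⊗ X ^^ n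
  X^^-+ zero    n = ≃-sym (⊗-identityˡ (X ^^ n))
  X^^-+ (suc m) n = begin
    X ^^ suc (m + n)          ≈⟨ X^^-suc (m + n) ⟩
    0# ∷ X ^^ (m + n)         ≈⟨ ∷-cong refl (X^^-+ m n) ⟩
    0# ∷ X ^^ m ⊗ X ^^ n      ≈⟨ 0∷-⊗ (X ^^ m) (X ^^ n) ⟨
    (0# ∷ X ^^ m) ⊗ X ^^ n    ≈⟨ ⊗-congʳ (X ^^ n) (X^^-suc m) ⟨
    X ^^ suc m ⊗ X ^^ n       ∎
    where open SetoidReasoning ≃-setoid

  coeff-X^^-+ : ∀ n i → coeff (X ^^ n) (n + i) ≈ coeff one i
  coeff-X^^-+ zero    i = refl
  coeff-X^^-+ (suc n) i = trans (X^^-suc n .coeff-≈ (suc (n + i))) (coeff-X^^-+ n i)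

  []q-+ : ∀ m n → [ m + n ]q ≃ [ m ]q ⊕ X ^^ m ⊗ [ n ]q
  []q-+ m zero = begin
    [ m + 0 ]q               ≡⟨ ≡.cong [_]q (ℕ.+-identityʳ m) ⟩
    [ m ]q                   ≈⟨ ⊕-identityʳ [ m ]q ⟨
    [ m ]q ⊕ []              ≈⟨ ⊕-congˡ (⊗-zeroʳ (X ^^ m)) ⟨
    [ m ]q ⊕ X ^^ m ⊗ []     ∎
    where open SetoidReasoning ≃-setoid
  []q-+ m (suc n) = begin
    [ m + suc n ]q                                 ≡⟨ ≡.cong [_]q (ℕ.+-suc m n) ⟩
    [ m + n ]q ⊕ X ^^ (m + n)                      ≈⟨ ⊕-cong ([]q-+ m n) (X^^-+ m n) ⟩
    ([ m ]q ⊕ X ^^ m ⊗ [ n ]q) ⊕ X ^^ m ⊗ X ^^ n   ≈⟨ ⊕-assoc [ m ]q _ _ ⟩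
    [ m ]q ⊕ (X ^^ m ⊗ [ n ]q ⊕ X ^^ m ⊗ X ^^ n)   ≈⟨ ⊕-congˡ (⊗-distribˡ (X ^^ m) [ n ]q (X ^^ n)) ⟨
    [ m ]q ⊕ X ^^ m ⊗ [ suc n ]q                   ∎
    where open SetoidReasoning ≃-setoid

  coeff-[suc]q-zero : ∀ n → coeff [ suc n ]q 0 ≈ 1#
  coeff-[suc]q-zero zero    = refl
  coeff-[suc]q-zero (suc n) =
    trans (coeff-⊕ [ suc n ]q (X ^^ suc n) 0)
      (trans (+-cong (coeff-[suc]q-zero n) (X^^-suc n .coeff-≈ 0)) (+-identityʳ 1#))

  coeff-[]q-+ : ∀ n i → coeff [ n ]q (n + i) ≈ 0#
  coeff-[]q-+ zero    i = refl
  coeff-[]q-+ (suc n) i = begin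
    coeff [ suc n ]q (suc n + i)                             ≈⟨ coeff-⊕ [ n ]q (X ^^ n) (suc n + i) ⟩
    coeff [ n ]q (suc (n + i)) +ᵣ coeff (X ^^ n) (suc (n + i))
      ≡⟨ ≡.cong (λ k → coeff [ n ]q k +ᵣ coeff (X ^^ n) k) (≡.sym (ℕ.+-suc n i)) ⟩
    coeff [ n ]q (n + suc i) +ᵣ coeff (X ^^ n) (n + suc i)   ≈⟨ +-cong (coeff-[]q-+ n (suc i)) (coeff-X^^-+ n (suc i)) ⟩
    0# +ᵣ 0#                                                 ≈⟨ +-identityˡ 0# ⟩
    0#                                                       ∎
    where open SetoidReasoning setoid

  expansion⇐ : (u v : ℕ → Pol) →
    (∀ m → 1 ≤ m → (u m ≋ one) × (v m ≋ X ^^ m)) →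
    ∀ m n → 1 ≤ m → 1 ≤ n → [ m + n ]q ≋ u m ⊗ [ m ]q ⊕ v m ⊗ [ n ]q
  expansion⇐ u v uv m n 1≤m _ = coeff-≈ (begin
    [ m + n ]q                          ≈⟨ []q-+ m n ⟩
    [ m ]q ⊕ X ^^ m ⊗ [ n ]q            ≈⟨ ⊕-congʳ (⊗-identityˡ [ m ]q) ⟨
    one ⊗ [ m ]q ⊕ X ^^ m ⊗ [ n ]q      ≈⟨ ⊕-cong (⊗-congʳ [ m ]q u≃one) (⊗-congʳ [ n ]q v≃X^^m) ⟨
    u m ⊗ [ m ]q ⊕ v m ⊗ [ n ]q         ∎)
    where
    open SetoidReasoning ≃-setoid
    u≃one : u m ≃ one
    u≃one = coeffwise (proj₁ (uv m 1≤m))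
    v≃X^^m : v m ≃ X ^^ m
    v≃X^^m = coeffwise (proj₂ (uv m 1≤m))

  expansion⇒ : (u v : ℕ → Pol) →
    (∀ m n → 1 ≤ m → 1 ≤ n → [ m + n ]q ≋ u m ⊗ [ m ]q ⊕ v m ⊗ [ n ]q) →
    ∀ m → 1 ≤ m → (u m ≋ one) × (v m ≋ X ^^ m)
  expansion⇒ u v expand m@(suc k) 1≤m = u≃one .coeff-≈ , v≃X^^m .coeff-≈
    where
    open SetoidReasoning ≃-setoid
    U = u m ⊗ [ m ]q

    expand-at : ∀ n → 1 ≤ n → [ n + m ]q ≃ U ⊕ v m ⊗ [ n ]q
    expand-at n 1≤n = ≃-trans (≃-reflexive (≡.cong [_]q (ℕ.+-comm n m))) (coeffwise (expand m n 1≤m 1≤n))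

    [m+1]⊕vq≃[m+2] : [ suc m ]q ⊕ v m ⊗ X ^^ 1 ≃ [ suc (suc m) ]q
    [m+1]⊕vq≃[m+2] = begin
      [ suc m ]q ⊕ v m ⊗ X ^^ 1                    ≈⟨ ⊕-congʳ (expand-at 1 (s≤s z≤n)) ⟩
      (U ⊕ v m ⊗ one) ⊕ v m ⊗ X ^^ 1               ≈⟨ ⊕-assoc U _ _ ⟩
      U ⊕ (v m ⊗ one ⊕ v m ⊗ X ^^ 1)               ≈⟨ ⊕-congˡ (⊗-distribˡ (v m) one (X ^^ 1)) ⟨
      U ⊕ v m ⊗ [ 2 ]q                             ≈⟨ expand-at 2 (s≤s z≤n) ⟨
      [ suc (suc m) ]q                             ∎

    v≃X^^m : v m ≃ X ^^ m
    v≃X^^m = coeffwise λ i → shifted .coeff-≈ (suc i)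
      where
      shifted : 0# ∷ v m ≃ 0# ∷ X ^^ m
      shifted = begin
        0# ∷ v m               ≈⟨ ∷-cong refl (⊗-identityʳ (v m)) ⟨
        0# ∷ v m ⊗ one         ≈⟨ ⊗-0∷ (v m) one ⟨
        v m ⊗ (0# ∷ one)       ≈⟨ ⊗-congˡ (v m) (X^^-suc 0) ⟨
        v m ⊗ X ^^ 1           ≈⟨ ⊕-cancelˡ [ suc m ]q [m+1]⊕vq≃[m+2] ⟩
        X ^^ suc m             ≈⟨ X^^-suc m ⟩
        0# ∷ X ^^ m            ∎

    u[m]≃[m] : U ≃ [ m ]q
    u[m]≃[m] = ⊕-cancelʳ (X ^^ m) (begin
      U ⊕ X ^^ m               ≈⟨ ⊕-congˡ (≃-trans (⊗-identityʳ (v m)) v≃X^^m) ⟨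
      U ⊕ v m ⊗ one            ≈⟨ expand-at 1 (s≤s z≤n) ⟨
      [ m ]q ⊕ X ^^ m          ∎)

    u≃one : u m ≃ one
    u≃one = ⊗-cancelʳ [ m ]q (coeff-[suc]q-zero k) (≃-trans u[m]≃[m] (≃-sym (⊗-identityˡ [ m ]q)))

  separable-square : ∀ a₁ a₂ b₁ b₂ → (a₁ +ᵣ b₁) +ᵣ (a₂ +ᵣ b₂) ≈ (a₁ +ᵣ b₂) +ᵣ (a₂ +ᵣ b₁)
  separable-square a₁ a₂ b₁ b₂ = begin
    (a₁ +ᵣ b₁) +ᵣ (a₂ +ᵣ b₂)  ≈⟨ interchange _ _ _ _ ⟩
    (a₁ +ᵣ a₂) +ᵣ (b₁ +ᵣ b₂)  ≈⟨ +-congˡ (+-comm b₁ b₂) ⟩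
    (a₁ +ᵣ a₂) +ᵣ (b₂ +ᵣ b₁)  ≈⟨ interchange _ _ _ _ ⟩
    (a₁ +ᵣ b₂) +ᵣ (a₂ +ᵣ b₁)  ∎
    where open SetoidReasoning setoid

  no-separable-expansion : ¬ (1# ≈ 0#) →
    ¬ (∃₂ λ (u v : ℕ → Pol) →
         ∀ m n → 1 ≤ m → 1 ≤ n → [ m + n ]q ≋ u m ⊗ [ m ]q ⊕ v n ⊗ [ n ]q)
  no-separable-expansion 1≉0 (u , v , expand) = 1≉0 (begin
    1#                                   ≈⟨ +-identityˡ 1# ⟨
    0# +ᵣ 1#                             ≈⟨ +-cong (coeff-[]q-+ 2 1) [4]₃≈1 ⟨
    coeff [ 2 ]q 3 +ᵣ coeff [ 4 ]q 3     ≈⟨ +-cong (entry 0 0) (entry 1 1) ⟩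
    (a 1 +ᵣ b 1) +ᵣ (a 2 +ᵣ b 2)         ≈⟨ separable-square (a 1) (a 2) (b 1) (b 2) ⟩
    (a 1 +ᵣ b 2) +ᵣ (a 2 +ᵣ b 1)         ≈⟨ +-cong (entry 0 1) (entry 1 0) ⟨
    coeff [ 3 ]q 3 +ᵣ coeff [ 3 ]q 3     ≈⟨ +-cong (coeff-[]q-+ 3 0) (coeff-[]q-+ 3 0) ⟩
    0# +ᵣ 0#                             ≈⟨ +-identityˡ 0# ⟩
    0#                                   ∎)
    where
    open SetoidReasoning setoid

    a b : ℕ → Carrier
    a m = coeff (u m ⊗ [ m ]q) 3
    b n = coeff (v n ⊗ [ n ]q) 3

    entry : ∀ m n → coeff [ suc m + suc n ]q 3 ≈ a (suc m) +ᵣ b (suc n)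
    entry m n = trans (expand (suc m) (suc n) (s≤s z≤n) (s≤s z≤n) 3) (coeff-⊕ (u (suc m) ⊗ _) _ 3)

    [4]₃≈1 : coeff [ 4 ]q 3 ≈ 1#
    [4]₃≈1 = trans (coeff-⊕ [ 3 ]q (X ^^ 3) 3) (trans (+-cong (coeff-[]q-+ 3 0) (coeff-X^^-+ 3 0)) (+-identityˡ 1#))

theorem4 : ∀ {c ℓ} (R : CommutativeRing c ℓ) →
    let open Poly R in
    ((u v : ℕ → Pol) →
      ((∀ m n → 1 ≤ m → 1 ≤ n → [ m + n ]q ≋ u m ⊗ [ m ]q ⊕ v m ⊗ [ n ]q)
        ⇔ (∀ m → 1 ≤ m → (u m ≋ one) × (v m ≋ X ^^ m))))
    × (¬ (CommutativeRing._≈_ R (CommutativeRing.1# R) (CommutativeRing.0# R)) →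
      ¬ (∃₂ λ (u v : ℕ → Pol) →
           ∀ m n → 1 ≤ m → 1 ≤ n → [ m + n ]q ≋ u m ⊗ [ m ]q ⊕ v n ⊗ [ n ]q))
theorem4 R =
  (λ u v → mk⇔ (expansion⇒ u v) (expansion⇐ u v)) , no-separable-expansion
  where open QuantumIntegers R
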